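{- Let $\Gamma$ be a finite, connected, simple, undirected graph with at least one edge and $m$ edges, $G$ a group, $s_2\in Z(G)$ with $s_2^2=1_G$, $H\in\mathcal H_\Gamma$, and $\pi$ a unitary representation of $G$ of degree $k$. Then $$\widehat{A_{L(\Gamma),\Psi_L(H)}}(\pi)=(I_m\otimes\pi(s_2))\bigl(\widehat H(\pi)^*\widehat H(\pi)-2I_{km}\bigr).$$
   Context: Fix orders $V_\Gamma=\{v_1,\dots,v_n\}$, $E_\Gamma=\{e_1,\dots,e_m\}$; write $v_i\in e_j$ if $v_i$ is an endpoint of $e_j$, and $e_i\cap e_j$ for the common endpoint of distinct edges sharing a vertex. $\mathbb CG$ is the complex group algebra of $G$. A $G$-phase of $\Gamma$ is $H\in M_{n\times m}(\mathbb CG)$ with $H_{i,j}\in G$ if $v_i\in e_j$ and $H_{i,j}=0$ otherwise; $\mathcal H_\Gamma$ is their set. The line graph $L(\Gamma)$ has vertex set $E_\Gamma$ (ordered $e_1,\dots,e_m$), $e_i\sim e_j$ iff they share an endpoint. $\Psi_L(H)$ is the $G$-gain function on $L(\Gamma)$ with $\Psi_L(H)(e_i,e_j)=s_2H_{k,i}^{ -1}H_{k,j}$ for $v_k=e_i\cap e_j$; for a gain function $\zeta$ on $L(\Gamma)$, $A_{L(\Gamma),\zeta}\in M_m(\mathbb CG)$ has $(i,j)$ entry $\zeta(e_i,e_j)$ if $e_i\sim e_j$ and $0$ otherwise. A representation of degree $k$ is a homomorphism $\pi\colon G\to GL_k(\mathbb C)$, unitary if all $\pi(g)$ are unitary. For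 $A\in M_{p\times q}(\mathbb CG)$, $\widehat A(\pi)\in M_{pk\times qk}(\mathbb C)$ is the block matrix whose $(i,j)$ block is $\sum_x a_x\pi(x)$ where $A_{i,j}=\sum_x a_xx$ (so an entry $g\in G$ becomes $\pi(g)$ and $0$ becomes the zero block). $M^*$ is the conjugate transpose, and $\otimes$ the Kronecker product. -}

module Defs where

open import Level using (Level; _⊔_)
open import Data.Nat using (ℕ; zero; suc; _≥_)
open import Data.Fin using (Fin; zero; suc)
open import Data.Fin.Properties using (_≟_)
open import Data.Product using (_×_; _,_; proj₁; proj₂; Σ)
open import Data.Sum using (_⊎_)
open import Relation.Nullary using (¬_; yes; no; Dec)
open import Relation.Binary.PropositionalEquality using (_≡_)
open import Algebra.Bundles using (CommutativeRing; Group)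

record StarRing (c ℓ : Level) : Set (Level.suc (c ⊔ ℓ)) where
  field
    commRing : CommutativeRing c ℓ
  open CommutativeRing commRing public
  field
    conj        : Carrier → Carrier
    conj-cong   : ∀ {x y} → x ≈ y → conj x ≈ conj y
    conj-invol  : ∀ x → conj (conj x) ≈ x
    conj-+      : ∀ x y → conj (x + y) ≈ conj x + conj y
    conj-*      : ∀ x y → conj (x * y) ≈ conj x * conj y
    conj-1      : conj 1# ≈ 1#

module Matrices {c ℓ : Level} (S : StarRing c ℓ) where
  open StarRing S using (Carrier; _≈_; _+_; _*_; _-_; 0#; 1#; conj)

  Σ[_] : ∀ n → (Fin n → Carrier) → Carrier
  Σ[ zero ]  f = 0#
  Σ[ suc n ] f = f zero + Σ[ n ] (λ i → f (suc i))

  Mat : ℕ → Set c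
  Mat k = Fin k → Fin k → Carrier

  _≈M_ : ∀ {k} → Mat k → Mat k → Set ℓ
  A ≈M B = ∀ a b → A a b ≈ B a b

  _*M_ : ∀ {k} → Mat k → Mat k → Mat k
  _*M_ {k} A B a b = Σ[ k ] (λ c → A a c * B c b)

  0M : ∀ {k} → Mat k
  0M a b = 0#

  IM : ∀ {k} → Mat k
  IM a b with a ≟ b
  ... | yes _ = 1#
  ... | no  _ = 0#

  _*ᴴ : ∀ {k} → Mat k → Mat k
  (A *ᴴ) a b = conj (A b a)

  -- A (pk × qk) complex matrix, viewed as a p × q array of k × k blocks:
  -- the (i , a) row / (j , b) column entry is  M i j a b.
  BMat : ℕ → ℕ → ℕ → Set c
  BMat k p q = Fin p → Fin q → Mat k

  _≈B_ : ∀ {k p q} → BMat k p q → BMat k p q → Set ℓ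
  M ≈B N = ∀ i j → M i j ≈M N i j

  _*B_ : ∀ {k p q r} → BMat k p q → BMat k q r → BMat k p r
  _*B_ {k} {p} {q} M N i j a b = Σ[ q ] (λ l → Σ[ k ] (λ c → M i l a c * N l j c b))

  _-B_ : ∀ {k p q} → BMat k p q → BMat k p q → BMat k p q
  (M -B N) i j a b = M i j a b - N i j a b

  _*ᴮ : ∀ {k p q} → BMat k p q → BMat k q p
  (M *ᴮ) i j a b = conj (M j i b a)

  _·B_ : ∀ {k p q} → Carrier → BMat k p q → BMat k p q
  (x ·B M) i j a b = x * M i j a b

  -- I_p ⊗ X  (Kronecker product, block diagonal with blocks X)
  I⊗ : ∀ {k} p → Mat k → BMat k p p
  I⊗ p X i j with i ≟ j
  ... | yes _ = X
  ... | no  _ = 0M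

  IB : ∀ {k} p → BMat k p p
  IB p = I⊗ p IM

  2# : Carrier
  2# = 1# + 1#

module Reps {c ℓ g ℓg : Level} (S : StarRing c ℓ) (G : Group g ℓg) where
  open Matrices S
  module G = Group G
  open StarRing S using (Carrier; _≈_)

  record UnitaryRep (k : ℕ) : Set (c ⊔ ℓ ⊔ g ⊔ ℓg) where
    field
      π        : G.Carrier → Mat k
      π-cong   : ∀ {x y} → x G.≈ y → π x ≈M π y
      π-hom    : ∀ x y → π (x G.∙ y) ≈M (π x *M π y)
      π-ε      : π G.ε ≈M IM
      unitaryˡ : ∀ x → ((π x *ᴴ) *M π x) ≈M IM
      unitaryʳ : ∀ x → (π x *M (π x *ᴴ)) ≈M IM

record Graph (n m : ℕ) : Set where
  field
    ends     : Fin m → Fin n × Fin n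
    loopless : ∀ e → ¬ (proj₁ (ends e) ≡ proj₂ (ends e))
    simple   : ∀ e f → ( (proj₁ (ends e) ≡ proj₁ (ends f) × proj₂ (ends e) ≡ proj₂ (ends f))
                       ⊎ (proj₁ (ends e) ≡ proj₂ (ends f) × proj₂ (ends e) ≡ proj₁ (ends f)) )
                     → e ≡ f

module GraphNotions {n m : ℕ} (Γ : Graph n m) where
  open Graph Γ

  _∈ₑ_ : Fin n → Fin m → Set
  v ∈ₑ e = v ≡ proj₁ (ends e) ⊎ v ≡ proj₂ (ends e)

  _∈ₑ?_ : ∀ v e → Dec (v ∈ₑ e)
  v ∈ₑ? e with v ≟ proj₁ (ends e) | v ≟ proj₂ (ends e)
  ... | yes p | _     = yes (Data.Sum.inj₁ p)
  ... | no _  | yes q = yes (Data.Sum.inj₂ q)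
  ... | no p  | no q  = no λ { (Data.Sum.inj₁ x) → p x ; (Data.Sum.inj₂ y) → q y }

  data Reachable : Fin n → Fin n → Set where
    here : ∀ {v} → Reachable v v
    step : ∀ {u w v} (e : Fin m) → u ∈ₑ e → w ∈ₑ e → Reachable w v → Reachable u v

  Connected : Set
  Connected = ∀ u v → Reachable u v

  _∼L_ : Fin m → Fin m → Set
  e ∼L f = ¬ (e ≡ f) × Σ (Fin n) (λ v → v ∈ₑ e × v ∈ₑ f)

  -- the common endpoint e ∩ f (meaningful when e ∼L f; in a simple graph it is unique)
  _∩ₑ_ : Fin m → Fin m → Fin n
  e ∩ₑ f with proj₁ (ends e) ∈ₑ? f
  ... | yes _ = proj₁ (ends e)
  ... | no  _ = proj₂ (ends e)

  _∼L?_ : ∀ e f → Dec (e ∼L f)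
  e ∼L? f with e ≟ f
  ... | yes p = no λ x → proj₁ x p
  ... | no p with proj₁ (ends e) ∈ₑ? f | proj₂ (ends e) ∈ₑ? f
  ...   | yes q | _     = yes (p , proj₁ (ends e) , Data.Sum.inj₁ _≡_.refl , q)
  ...   | no _  | yes r = yes (p , proj₂ (ends e) , Data.Sum.inj₂ _≡_.refl , r)
  ...   | no q  | no r  = no λ { (_ , v , Data.Sum.inj₁ _≡_.refl , s) → q s
                               ; (_ , v , Data.Sum.inj₂ _≡_.refl , s) → r s }

module Phases {c ℓ g ℓg : Level} (S : StarRing c ℓ) (G : Group g ℓg)
              {n m : ℕ} (Γ : Graph n m) where
  open Matrices S
  open Reps S G
  open GraphNotions Γ
  open Group G using () renaming (Carrier to ∣G∣; _∙_ to _∙ᴳ_; _⁻¹ to _⁻¹ᴳ)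

  -- A G-phase: an element H_{i,j} ∈ G for each incident pair v_i ∈ e_j
  -- (entries with v_i ∉ e_j are 0 in ℂG; they are never consulted here).
  GPhase : Set g
  GPhase = (i : Fin n) (j : Fin m) → i ∈ₑ j → ∣G∣

  Ĥ : ∀ {k} → GPhase → UnitaryRep k → BMat k n m
  Ĥ H ρ i j with i ∈ₑ? j
  ... | yes p = UnitaryRep.π ρ (H i j p)
  ... | no  _ = 0M

  Ψ_L : (s₂ : ∣G∣) (H : GPhase) (i j : Fin m) → i ∼L j → ∣G∣
  Ψ_L s₂ H i j adj with (i ∩ₑ j) ∈ₑ? i | (i ∩ₑ j) ∈ₑ? j
  ... | yes p | yes q = s₂ ∙ᴳ ((H (i ∩ₑ j) i p ⁻¹ᴳ) ∙ᴳ H (i ∩ₑ j) j q)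
  ... | _     | _     = s₂   -- unreachable when i ∼L j

  ÂL : ∀ {k} → ((i j : Fin m) → i ∼L j → ∣G∣) → UnitaryRep k → BMat k m m
  ÂL ζ ρ i j with i ∼L? j
  ... | yes p = UnitaryRep.π ρ (ζ i j p)
  ... | no  _ = 0M

-- The (i, j) block of Ĥ(π)* Ĥ(π) is the sum of π(H_{v,i})* π(H_{v,j}) over the
-- common endpoints v of e_i and e_j, and unitarity turns each summand into
-- π(H_{v,i}⁻¹ H_{v,j}).  An edge has exactly two endpoints, so every diagonal
-- block is 2I; two distinct edges of a simple graph share at most one endpoint,
-- so an off-diagonal block is π(H_{v,i}⁻¹ H_{v,j}) with v = e_i ∩ e_j when
-- e_i ∼ e_j, and 0 otherwise.  Left multiplication by I ⊗ π(s₂) then contributes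
-- the factor s₂ of Ψ_L(H).

module Submission where

open import Defs
open import Level using (Level)
open import Data.Nat using (ℕ; _≥_; zero; suc)
open import Data.Fin using (Fin; zero; suc)
open import Data.Fin.Properties using (_≟_; suc-injective)
open import Data.Product using (_×_; _,_; proj₁; proj₂)
open import Data.Sum using (_⊎_; inj₁; inj₂)
open import Data.Empty using (⊥-elim)
open import Function using (_∘_)
open import Relation.Nullary using (¬_; Dec; yes; no)
open import Relation.Binary.PropositionalEquality as ≡ using (_≡_)
open import Relation.Binary.Bundles using (Setoid)
open import Algebra.Bundles using (Group)
import Algebra.Properties.Semiring.Sum as SemiringSum
import Algebra.Properties.Ring as RingProperties
import Data.Vec.Functional.Relation.Binary.Equality.Setoid as VectorEquality
import Relation.Binary.Reasoning.Setoid as SetoidReasoning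

module StarRingMatrices {c ℓ : Level} (S : StarRing c ℓ) where
  open StarRing S hiding (zero)
  open Matrices S
  open SemiringSum semiring using (sum; sum-cong-≋; sum-replicate-zero; ∑-comm; *-distribˡ-sum; *-distribʳ-sum)
  open RingProperties ring using (-0#≈0#; x+x≈x⇒x≈0)
  open SetoidReasoning setoid

  conj-0# : conj 0# ≈ 0#
  conj-0# = x+x≈x⇒x≈0 (conj 0#) (begin
    conj 0# + conj 0# ≈⟨ conj-+ 0# 0# ⟨
    conj (0# + 0#)    ≈⟨ conj-cong (+-identityʳ 0#) ⟩
    conj 0#           ∎)

  2#*x≈x+x : ∀ x → 2# * x ≈ x + x
  2#*x≈x+x x = trans (distribʳ x 1# 1#) (+-cong (*-identityˡ x) (*-identityˡ x))

  x-2#*0#≈x : ∀ x → x - 2# * 0# ≈ x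
  x-2#*0#≈x x = trans (+-congˡ (trans (-‿cong (zeroʳ 2#)) -0#≈0#)) (+-identityʳ x)

  Σ≡sum : ∀ p (f : Fin p → Carrier) → Σ[ p ] f ≡ sum f
  Σ≡sum zero    f = ≡.refl
  Σ≡sum (suc p) f = ≡.cong (f zero +_) (Σ≡sum p (λ i → f (suc i)))

  Σ≈sum : ∀ p (f : Fin p → Carrier) → Σ[ p ] f ≈ sum f
  Σ≈sum p f = reflexive (Σ≡sum p f)

  Σ-cong : ∀ p {f h : Fin p → Carrier} → (∀ i → f i ≈ h i) → Σ[ p ] f ≈ Σ[ p ] h
  Σ-cong p {f} {h} f≈h = begin
    Σ[ p ] f ≈⟨ Σ≈sum p f ⟩
    sum f    ≈⟨ sum-cong-≋ f≈h ⟩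
    sum h    ≈⟨ Σ≈sum p h ⟨
    Σ[ p ] h ∎

  Σ-zero : ∀ p {f : Fin p → Carrier} → (∀ i → f i ≈ 0#) → Σ[ p ] f ≈ 0#
  Σ-zero p {f} f≈0 = begin
    Σ[ p ] f           ≈⟨ Σ≈sum p f ⟩
    sum f              ≈⟨ sum-cong-≋ f≈0 ⟩
    sum {p} (λ _ → 0#) ≈⟨ sum-replicate-zero p ⟩
    0#                 ∎

  Σ-comm : ∀ p q (f : Fin p → Fin q → Carrier) →
           Σ[ p ] (λ i → Σ[ q ] (f i)) ≈ Σ[ q ] (λ j → Σ[ p ] (λ i → f i j))
  Σ-comm p q f = begin
    Σ[ p ] (λ i → Σ[ q ] (f i))            ≈⟨ Σ≈sum p _ ⟩
    sum (λ i → Σ[ q ] (f i))               ≈⟨ sum-cong-≋ (λ i → Σ≈sum q (f i)) ⟩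
    sum (λ i → sum (f i))                  ≈⟨ ∑-comm f ⟩
    sum (λ j → sum (λ i → f i j))          ≈⟨ sum-cong-≋ (λ j → Σ≈sum p (λ i → f i j)) ⟨
    sum (λ j → Σ[ p ] (λ i → f i j))       ≈⟨ Σ≈sum q _ ⟨
    Σ[ q ] (λ j → Σ[ p ] (λ i → f i j))    ∎

  *-distribˡ-Σ : ∀ p x (f : Fin p → Carrier) → x * Σ[ p ] f ≈ Σ[ p ] (λ i → x * f i)
  *-distribˡ-Σ p x f = begin
    x * Σ[ p ] f            ≈⟨ *-congˡ (Σ≈sum p f) ⟩
    x * sum f               ≈⟨ *-distribˡ-sum x f ⟩
    sum (λ i → x * f i)     ≈⟨ Σ≈sum p _ ⟨
    Σ[ p ] (λ i → x * f i)  ∎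

  *-distribʳ-Σ : ∀ p x (f : Fin p → Carrier) → Σ[ p ] f * x ≈ Σ[ p ] (λ i → f i * x)
  *-distribʳ-Σ p x f = begin
    Σ[ p ] f * x            ≈⟨ *-congʳ (Σ≈sum p f) ⟩
    sum f * x               ≈⟨ *-distribʳ-sum x f ⟩
    sum (λ i → f i * x)     ≈⟨ Σ≈sum p _ ⟨
    Σ[ p ] (λ i → f i * x)  ∎

  Σ-single : ∀ p (u : Fin p) (f : Fin p → Carrier) → (∀ l → ¬ l ≡ u → f l ≈ 0#) → Σ[ p ] f ≈ f u
  Σ-single (suc p) zero    f f≈0 =
    trans (+-congˡ (Σ-zero p (λ l → f≈0 (suc l) λ ()))) (+-identityʳ _)
  Σ-single (suc p) (suc u) f f≈0 =
    trans (+-cong (f≈0 zero λ ()) (Σ-single p u (λ l → f (suc l)) (λ l l≢u → f≈0 (suc l) (l≢u ∘ suc-injective))))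
          (+-identityˡ _)

  Σ-pair : ∀ p (u w : Fin p) (f : Fin p → Carrier) → ¬ u ≡ w →
           (∀ l → ¬ l ≡ u → ¬ l ≡ w → f l ≈ 0#) → Σ[ p ] f ≈ f u + f w
  Σ-pair (suc p) zero    zero    f u≢w f≈0 = ⊥-elim (u≢w ≡.refl)
  Σ-pair (suc p) zero    (suc w) f u≢w f≈0 =
    +-congˡ (Σ-single p w (f ∘ suc) (λ l l≢w → f≈0 (suc l) (λ ()) (l≢w ∘ suc-injective)))
  Σ-pair (suc p) (suc u) zero    f u≢w f≈0 =
    trans (+-congˡ (Σ-single p u (f ∘ suc) (λ l l≢u → f≈0 (suc l) (l≢u ∘ suc-injective) (λ ()))))
          (+-comm _ _)
  Σ-pair (suc p) (suc u) (suc w) f u≢w f≈0 =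
    trans (+-cong (f≈0 zero (λ ()) (λ ()))
                  (Σ-pair p u w (f ∘ suc) (u≢w ∘ ≡.cong suc)
                     (λ l l≢u l≢w → f≈0 (suc l) (l≢u ∘ suc-injective) (l≢w ∘ suc-injective))))
          (+-identityˡ _)

  Mat-setoid : ℕ → Setoid c ℓ
  Mat-setoid k = VectorEquality.≋-setoid (VectorEquality.≋-setoid setoid k) k

  module ≈M-Reasoning {k : ℕ} = SetoidReasoning (Mat-setoid k)

  ≈M-refl : ∀ {k} {A : Mat k} → A ≈M A
  ≈M-refl = Setoid.refl (Mat-setoid _)

  *M-cong : ∀ {k} {A A′ B B′ : Mat k} → A ≈M A′ → B ≈M B′ → (A *M B) ≈M (A′ *M B′)
  *M-cong {k} A≈A′ B≈B′ a b = Σ-cong k (λ c → *-cong (A≈A′ a c) (B≈B′ c b))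

  *M-congˡ : ∀ {k} (A : Mat k) {B B′ : Mat k} → B ≈M B′ → (A *M B) ≈M (A *M B′)
  *M-congˡ A = *M-cong ≈M-refl

  *M-congʳ : ∀ {k} {A A′ : Mat k} (B : Mat k) → A ≈M A′ → (A *M B) ≈M (A′ *M B)
  *M-congʳ B A≈A′ = *M-cong A≈A′ ≈M-refl

  *M-assoc : ∀ {k} (A B C : Mat k) → ((A *M B) *M C) ≈M (A *M (B *M C))
  *M-assoc {k} A B C a b = begin
    Σ[ k ] (λ c → Σ[ k ] (λ d → A a d * B d c) * C c b)   ≈⟨ Σ-cong k (λ c → *-distribʳ-Σ k (C c b) _) ⟩
    Σ[ k ] (λ c → Σ[ k ] (λ d → A a d * B d c * C c b))   ≈⟨ Σ-comm k k _ ⟩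
    Σ[ k ] (λ d → Σ[ k ] (λ c → A a d * B d c * C c b))   ≈⟨ Σ-cong k (λ d → Σ-cong k (λ c → *-assoc (A a d) (B d c) (C c b))) ⟩
    Σ[ k ] (λ d → Σ[ k ] (λ c → A a d * (B d c * C c b))) ≈⟨ Σ-cong k (λ d → *-distribˡ-Σ k (A a d) _) ⟨
    Σ[ k ] (λ d → A a d * Σ[ k ] (λ c → B d c * C c b))   ∎

  IM-diag : ∀ {k} (a : Fin k) → IM a a ≡ 1#
  IM-diag a with a ≟ a
  ... | yes _   = ≡.refl
  ... | no  a≢a = ⊥-elim (a≢a ≡.refl)

  IM-off : ∀ {k} {a b : Fin k} → ¬ a ≡ b → IM a b ≡ 0#
  IM-off {a = a} {b} a≢b with a ≟ b
  ... | yes a≡b = ⊥-elim (a≢b a≡b)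
  ... | no  _   = ≡.refl

  *M-identityˡ : ∀ {k} (A : Mat k) → (IM *M A) ≈M A
  *M-identityˡ {k} A a b = begin
    Σ[ k ] (λ c → IM a c * A c b) ≈⟨ Σ-single k a _ (λ c c≢a → trans (*-congʳ (reflexive (IM-off (c≢a ∘ ≡.sym)))) (zeroˡ _)) ⟩
    IM a a * A a b                ≈⟨ *-congʳ (reflexive (IM-diag a)) ⟩
    1# * A a b                    ≈⟨ *-identityˡ _ ⟩
    A a b                         ∎

  *M-identityʳ : ∀ {k} (A : Mat k) → (A *M IM) ≈M A
  *M-identityʳ {k} A a b = begin
    Σ[ k ] (λ c → A a c * IM c b) ≈⟨ Σ-single k b _ (λ c c≢b → trans (*-congˡ (reflexive (IM-off c≢b))) (zeroʳ _)) ⟩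
    A a b * IM b b                ≈⟨ *-congˡ (reflexive (IM-diag b)) ⟩
    A a b * 1#                    ≈⟨ *-identityʳ _ ⟩
    A a b                         ∎

  *M-zeroˡ : ∀ {k} (A : Mat k) → (0M *M A) ≈M 0M
  *M-zeroˡ {k} A a b = Σ-zero k (λ c → zeroˡ _)

  *M-zeroʳ : ∀ {k} (A : Mat k) → (A *M 0M) ≈M 0M
  *M-zeroʳ {k} A a b = Σ-zero k (λ c → zeroʳ _)

  0M-*ᴴ : ∀ {k} → (0M *ᴴ) ≈M 0M {k}
  0M-*ᴴ a b = conj-0#

  I⊗-diag : ∀ {k} p (X : Mat k) (i : Fin p) → I⊗ p X i i ≡ X
  I⊗-diag p X i with i ≟ i
  ... | yes _   = ≡.refl
  ... | no  i≢i = ⊥-elim (i≢i ≡.refl)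

  I⊗-off : ∀ {k} p (X : Mat k) {i j : Fin p} → ¬ i ≡ j → I⊗ p X i j ≡ 0M
  I⊗-off p X {i} {j} i≢j with i ≟ j
  ... | yes i≡j = ⊥-elim (i≢j i≡j)
  ... | no  _   = ≡.refl

  I⊗-*B : ∀ {k p q} (X : Mat k) (M : BMat k p q) i j → (I⊗ p X *B M) i j ≈M (X *M M i j)
  I⊗-*B {k} {p} X M i j a b = begin
    Σ[ p ] (λ l → (I⊗ p X i l *M M l j) a b) ≈⟨ Σ-single p i _ (λ l l≢i → off l (l≢i ∘ ≡.sym)) ⟩
    (I⊗ p X i i *M M i j) a b                ≡⟨ ≡.cong (λ Y → (Y *M M i j) a b) (I⊗-diag p X i) ⟩
    (X *M M i j) a b                         ∎
    where
    off : ∀ l → ¬ i ≡ l → (I⊗ p X i l *M M l j) a b ≈ 0#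
    off l i≢l rewrite I⊗-off p X i≢l = *M-zeroˡ (M l j) a b

module UnitaryRepLemmas {c ℓ g ℓg : Level} (S : StarRing c ℓ) (G : Group g ℓg)
                        {k : ℕ} (ρ : Reps.UnitaryRep S G k) where
  open Matrices S
  open StarRingMatrices S
  open Reps.UnitaryRep ρ
  open Group G using (_∙_; _⁻¹; ε; inverseʳ)
  open ≈M-Reasoning

  π-⁻¹ : ∀ x → π (x ⁻¹) ≈M (π x *ᴴ)
  π-⁻¹ x = begin
    π (x ⁻¹)                        ≈⟨ *M-identityˡ _ ⟨
    IM *M π (x ⁻¹)                  ≈⟨ *M-congʳ _ (unitaryˡ x) ⟨
    ((π x *ᴴ) *M π x) *M π (x ⁻¹)  ≈⟨ *M-assoc _ _ _ ⟩
    (π x *ᴴ) *M (π x *M π (x ⁻¹))  ≈⟨ *M-congˡ _ (π-hom x (x ⁻¹)) ⟨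
    (π x *ᴴ) *M π (x ∙ x ⁻¹)       ≈⟨ *M-congˡ _ (π-cong (inverseʳ x)) ⟩
    (π x *ᴴ) *M π ε                 ≈⟨ *M-congˡ _ π-ε ⟩
    (π x *ᴴ) *M IM                  ≈⟨ *M-identityʳ _ ⟩
    π x *ᴴ                          ∎

  π-*ᴴ-* : ∀ x y → ((π x *ᴴ) *M π y) ≈M π (x ⁻¹ ∙ y)
  π-*ᴴ-* x y = begin
    (π x *ᴴ) *M π y     ≈⟨ *M-congʳ _ (π-⁻¹ x) ⟨
    π (x ⁻¹) *M π y     ≈⟨ π-hom (x ⁻¹) y ⟨
    π (x ⁻¹ ∙ y)        ∎

module SimpleGraphLemmas {n m : ℕ} (Γ : Graph n m) where
  open Graph Γ
  open GraphNotions Γ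

  ∈ₑ-irrelevant : ∀ {v e} (p q : v ∈ₑ e) → p ≡ q
  ∈ₑ-irrelevant (inj₁ ≡.refl) (inj₁ ≡.refl) = ≡.refl
  ∈ₑ-irrelevant {e = e} (inj₁ ≡.refl) (inj₂ q) = ⊥-elim (loopless e q)
  ∈ₑ-irrelevant {e = e} (inj₂ ≡.refl) (inj₁ q) = ⊥-elim (loopless e (≡.sym q))
  ∈ₑ-irrelevant (inj₂ ≡.refl) (inj₂ ≡.refl) = ≡.refl

  distinct-ends : ∀ {x y e} → ¬ x ≡ y → x ∈ₑ e → y ∈ₑ e →
                  (x ≡ proj₁ (ends e) × y ≡ proj₂ (ends e)) ⊎ (x ≡ proj₂ (ends e) × y ≡ proj₁ (ends e))
  distinct-ends x≢y (inj₁ x≡a) (inj₁ y≡a) = ⊥-elim (x≢y (≡.trans x≡a (≡.sym y≡a)))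
  distinct-ends x≢y (inj₁ x≡a) (inj₂ y≡b) = inj₁ (x≡a , y≡b)
  distinct-ends x≢y (inj₂ x≡b) (inj₁ y≡a) = inj₂ (x≡b , y≡a)
  distinct-ends x≢y (inj₂ x≡b) (inj₂ y≡b) = ⊥-elim (x≢y (≡.trans x≡b (≡.sym y≡b)))

  two-common-ends⇒≡ : ∀ {x y e f} → ¬ x ≡ y → x ∈ₑ e → y ∈ₑ e → x ∈ₑ f → y ∈ₑ f → e ≡ f
  two-common-ends⇒≡ {e = e} {f} x≢y x∈e y∈e x∈f y∈f
    with distinct-ends x≢y x∈e y∈e | distinct-ends x≢y x∈f y∈f
  ... | inj₁ (p , q) | inj₁ (r , s) = simple e f (inj₁ (≡.trans (≡.sym p) r , ≡.trans (≡.sym q) s))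
  ... | inj₁ (p , q) | inj₂ (r , s) = simple e f (inj₂ (≡.trans (≡.sym p) r , ≡.trans (≡.sym q) s))
  ... | inj₂ (p , q) | inj₁ (r , s) = simple e f (inj₂ (≡.trans (≡.sym q) s , ≡.trans (≡.sym p) r))
  ... | inj₂ (p , q) | inj₂ (r , s) = simple e f (inj₁ (≡.trans (≡.sym q) s , ≡.trans (≡.sym p) r))

  ∩ₑ-common : ∀ {e f} → e ∼L f → (e ∩ₑ f) ∈ₑ e × (e ∩ₑ f) ∈ₑ f
  ∩ₑ-common {e} {f} (_ , w , w∈e , w∈f) with proj₁ (ends e) ∈ₑ? f
  ... | yes a∈f = inj₁ ≡.refl , a∈f
  ... | no  a∉f = inj₂ ≡.refl , b∈f w∈e
    where
    b∈f : w ∈ₑ e → proj₂ (ends e) ∈ₑ f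
    b∈f (inj₁ ≡.refl) = ⊥-elim (a∉f w∈f)
    b∈f (inj₂ ≡.refl) = w∈f

  ∩ₑ-unique : ∀ {e f v} → e ∼L f → v ∈ₑ e → v ∈ₑ f → v ≡ e ∩ₑ f
  ∩ₑ-unique {e} {f} {v} e∼f v∈e v∈f with v ≟ e ∩ₑ f
  ... | yes v≡u = v≡u
  ... | no  v≢u = ⊥-elim (proj₁ e∼f (two-common-ends⇒≡ v≢u v∈e u∈e v∈f u∈f))
    where
    u∈e : (e ∩ₑ f) ∈ₑ e
    u∈e = proj₁ (∩ₑ-common e∼f)
    u∈f : (e ∩ₑ f) ∈ₑ f
    u∈f = proj₂ (∩ₑ-common e∼f)

module PhaseLemmas {c ℓ g ℓg : Level} (S : StarRing c ℓ) (G : Group g ℓg)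
                   {n m : ℕ} (Γ : Graph n m) (H : Phases.GPhase S G Γ)
                   {k : ℕ} (ρ : Reps.UnitaryRep S G k) where
  open StarRing S hiding (zero)
  open Matrices S
  open StarRingMatrices S
  open Reps.UnitaryRep ρ
  open UnitaryRepLemmas S G ρ
  open Graph Γ
  open GraphNotions Γ
  open SimpleGraphLemmas Γ
  open Phases S G Γ
  open Group G using (_∙_; _⁻¹; inverseˡ)

  Ĥ-∈ : ∀ {v e} (v∈e : v ∈ₑ e) → Ĥ H ρ v e ≡ π (H v e v∈e)
  Ĥ-∈ {v} {e} v∈e with v ∈ₑ? e
  ... | yes v∈e′ = ≡.cong (π ∘ H v e) (∈ₑ-irrelevant v∈e′ v∈e)
  ... | no  v∉e  = ⊥-elim (v∉e v∈e)

  Ĥ-∉ : ∀ {v e} → ¬ v ∈ₑ e → Ĥ H ρ v e ≡ 0M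
  Ĥ-∉ {v} {e} v∉e with v ∈ₑ? e
  ... | yes v∈e = ⊥-elim (v∉e v∈e)
  ... | no  _   = ≡.refl

  Ĥᴴ-Ĥ-∈ : ∀ {l i j} (l∈i : l ∈ₑ i) (l∈j : l ∈ₑ j) →
           ((Ĥ H ρ l i *ᴴ) *M Ĥ H ρ l j) ≈M π (H l i l∈i ⁻¹ ∙ H l j l∈j)
  Ĥᴴ-Ĥ-∈ l∈i l∈j rewrite Ĥ-∈ l∈i | Ĥ-∈ l∈j = π-*ᴴ-* _ _

  Ĥᴴ-Ĥ-∉ : ∀ {l i j} → ¬ (l ∈ₑ i × l ∈ₑ j) → ((Ĥ H ρ l i *ᴴ) *M Ĥ H ρ l j) ≈M 0M
  Ĥᴴ-Ĥ-∉ {l} {i} {j} l∉i∩j = by-cases (l ∈ₑ? i)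
    where
    open ≈M-Reasoning
    by-cases : Dec (l ∈ₑ i) → ((Ĥ H ρ l i *ᴴ) *M Ĥ H ρ l j) ≈M 0M
    by-cases (no l∉i) = begin
      (Ĥ H ρ l i *ᴴ) *M Ĥ H ρ l j  ≡⟨ ≡.cong (λ X → (X *ᴴ) *M Ĥ H ρ l j) (Ĥ-∉ l∉i) ⟩
      (0M *ᴴ) *M Ĥ H ρ l j         ≈⟨ *M-congʳ _ 0M-*ᴴ ⟩
      0M *M Ĥ H ρ l j              ≈⟨ *M-zeroˡ _ ⟩
      0M                           ∎
    by-cases (yes l∈i) = begin
      (Ĥ H ρ l i *ᴴ) *M Ĥ H ρ l j  ≡⟨ ≡.cong ((Ĥ H ρ l i *ᴴ) *M_) (Ĥ-∉ (λ l∈j → l∉i∩j (l∈i , l∈j))) ⟩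
      (Ĥ H ρ l i *ᴴ) *M 0M         ≈⟨ *M-zeroʳ _ ⟩
      0M                           ∎

  ĤᴴĤ : BMat k m m
  ĤᴴĤ = (Ĥ H ρ *ᴮ) *B Ĥ H ρ

  ĤᴴĤ-diag : ∀ i a b → ĤᴴĤ i i a b ≈ IM a b + IM a b
  ĤᴴĤ-diag i a b = begin
    Σ[ n ] (λ l → term l)                ≈⟨ Σ-pair n end₁ end₂ term (loopless i) off-ends ⟩
    term end₁ + term end₂                ≈⟨ +-cong (at-end (inj₁ ≡.refl)) (at-end (inj₂ ≡.refl)) ⟩
    IM a b + IM a b                      ∎
    where
    open SetoidReasoning setoid
    end₁ end₂ : Fin n
    end₁ = proj₁ (ends i)
    end₂ = proj₂ (ends i)
    term : Fin n → Carrier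
    term l = ((Ĥ H ρ l i *ᴴ) *M Ĥ H ρ l i) a b
    off-ends : ∀ l → ¬ l ≡ end₁ → ¬ l ≡ end₂ → term l ≈ 0#
    off-ends l l≢end₁ l≢end₂ =
      Ĥᴴ-Ĥ-∉ (λ { (inj₁ l≡end₁ , _) → l≢end₁ l≡end₁ ; (inj₂ l≡end₂ , _) → l≢end₂ l≡end₂ }) a b
    at-end : ∀ {l} (l∈i : l ∈ₑ i) → term l ≈ IM a b
    at-end l∈i = trans (Ĥᴴ-Ĥ-∈ l∈i l∈i a b) (trans (π-cong (inverseˡ _) a b) (π-ε a b))

  ĤᴴĤ-nonadjacent : ∀ {i j} → ¬ i ≡ j → ¬ i ∼L j → ĤᴴĤ i j ≈M 0M
  ĤᴴĤ-nonadjacent i≢j i≁j a b =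
    Σ-zero n (λ l → Ĥᴴ-Ĥ-∉ (λ { (l∈i , l∈j) → i≁j (i≢j , l , l∈i , l∈j) }) a b)

  H⁻¹H : ∀ {i j} → i ∼L j → Group.Carrier G
  H⁻¹H {i} {j} i∼j = H (i ∩ₑ j) i (proj₁ (∩ₑ-common i∼j)) ⁻¹ ∙ H (i ∩ₑ j) j (proj₂ (∩ₑ-common i∼j))

  ĤᴴĤ-adjacent : ∀ {i j} (i∼j : i ∼L j) → ĤᴴĤ i j ≈M π (H⁻¹H i∼j)
  ĤᴴĤ-adjacent {i} {j} i∼j a b =
    trans (Σ-single n (i ∩ₑ j) _ off-common)
          (Ĥᴴ-Ĥ-∈ (proj₁ (∩ₑ-common i∼j)) (proj₂ (∩ₑ-common i∼j)) a b)
    where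
    off-common : ∀ l → ¬ l ≡ i ∩ₑ j → ((Ĥ H ρ l i *ᴴ) *M Ĥ H ρ l j) a b ≈ 0#
    off-common l l≢∩ = Ĥᴴ-Ĥ-∉ (λ { (l∈i , l∈j) → l≢∩ (∩ₑ-unique i∼j l∈i l∈j) }) a b

  defect : BMat k m m
  defect = ĤᴴĤ -B (2# ·B IB m)

  defect-diag : ∀ i → defect i i ≈M 0M
  defect-diag i a b = begin
    ĤᴴĤ i i a b - 2# * IB m i i a b     ≈⟨ +-cong (ĤᴴĤ-diag i a b) (-‿cong (*-congˡ IB-ii)) ⟩
    (IM a b + IM a b) - 2# * IM a b     ≈⟨ +-congˡ (-‿cong (2#*x≈x+x (IM a b))) ⟩
    (IM a b + IM a b) - (IM a b + IM a b) ≈⟨ -‿inverseʳ _ ⟩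
    0#                                  ∎
    where
    open SetoidReasoning setoid
    IB-ii : IB m i i a b ≈ IM a b
    IB-ii = reflexive (≡.cong (λ X → X a b) (I⊗-diag m IM i))

  defect-off : ∀ {i j} → ¬ i ≡ j → defect i j ≈M ĤᴴĤ i j
  defect-off {i} {j} i≢j a b =
    trans (+-congˡ (-‿cong (*-congˡ (reflexive (≡.cong (λ X → X a b) (I⊗-off m IM i≢j))))))
          (x-2#*0#≈x _)

  defect-nonadjacent : ∀ i j → ¬ i ∼L j → defect i j ≈M 0M
  defect-nonadjacent i j i≁j = by-cases (i ≟ j)
    where
    by-cases : Dec (i ≡ j) → defect i j ≈M 0M
    by-cases (yes ≡.refl) = defect-diag i
    by-cases (no  i≢j)    = λ a b → trans (defect-off i≢j a b) (ĤᴴĤ-nonadjacent i≢j i≁j a b)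

  defect-adjacent : ∀ {i j} (i∼j : i ∼L j) → defect i j ≈M π (H⁻¹H i∼j)
  defect-adjacent i∼j a b = trans (defect-off (proj₁ i∼j) a b) (ĤᴴĤ-adjacent i∼j a b)

  Ψ_L-≡ : ∀ s₂ {i j} (i∼j : i ∼L j) → Ψ_L s₂ H i j i∼j ≡ s₂ ∙ H⁻¹H i∼j
  Ψ_L-≡ s₂ {i} {j} i∼j with (i ∩ₑ j) ∈ₑ? i | (i ∩ₑ j) ∈ₑ? j
  ... | yes ∩∈i | yes ∩∈j =
    ≡.cong₂ (λ p q → s₂ ∙ (H (i ∩ₑ j) i p ⁻¹ ∙ H (i ∩ₑ j) j q))
            (∈ₑ-irrelevant ∩∈i (proj₁ (∩ₑ-common i∼j))) (∈ₑ-irrelevant ∩∈j (proj₂ (∩ₑ-common i∼j)))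
  ... | no ∩∉i | _       = ⊥-elim (∩∉i (proj₁ (∩ₑ-common i∼j)))
  ... | yes _  | no ∩∉j  = ⊥-elim (∩∉j (proj₂ (∩ₑ-common i∼j)))

  ÂL-Ψ_L : ∀ s₂ i j → ÂL (Ψ_L s₂ H) ρ i j ≈M (π s₂ *M defect i j)
  ÂL-Ψ_L s₂ i j with i ∼L? j
  ... | yes i∼j = begin
    π (Ψ_L s₂ H i j i∼j)       ≡⟨ ≡.cong π (Ψ_L-≡ s₂ i∼j) ⟩
    π (s₂ ∙ H⁻¹H i∼j)          ≈⟨ π-hom s₂ (H⁻¹H i∼j) ⟩
    π s₂ *M π (H⁻¹H i∼j)       ≈⟨ *M-congˡ (π s₂) (defect-adjacent i∼j) ⟨
    π s₂ *M defect i j         ∎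
    where open ≈M-Reasoning
  ... | no i≁j = begin
    0M                         ≈⟨ *M-zeroʳ (π s₂) ⟨
    π s₂ *M 0M                 ≈⟨ *M-congˡ (π s₂) (defect-nonadjacent i j i≁j) ⟨
    π s₂ *M defect i j         ∎
    where open ≈M-Reasoning

theorem5p4 : ∀ {c ℓ g ℓg : Level} (S : StarRing c ℓ) (G : Group g ℓg)
               {n m : ℕ} (Γ : Graph n m) →
               GraphNotions.Connected Γ → m ≥ 1 →
               (s₂ : Group.Carrier G) →
               (∀ x → Group._≈_ G (Group._∙_ G s₂ x) (Group._∙_ G x s₂)) →
               Group._≈_ G (Group._∙_ G s₂ s₂) (Group.ε G) →
               (H : Phases.GPhase S G Γ) →
               {k : ℕ} (ρ : Reps.UnitaryRep S G k) →
               let open Matrices S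
                   open Phases S G Γ
               in ÂL (Ψ_L s₂ H) ρ
                  ≈B (I⊗ m (Reps.UnitaryRep.π ρ s₂)
                      *B (((Ĥ H ρ *ᴮ) *B Ĥ H ρ) -B (2# ·B IB m)))
theorem5p4 S G Γ _ _ s₂ _ _ H ρ i j = begin
  ÂL (Ψ_L s₂ H) ρ i j                   ≈⟨ ÂL-Ψ_L s₂ i j ⟩
  π s₂ *M defect i j                    ≈⟨ I⊗-*B (π s₂) defect i j ⟨
  (I⊗ _ (π s₂) *B defect) i j           ∎
  where
  open Matrices S
  open Phases S G Γ
  open StarRingMatrices S
  open PhaseLemmas S G Γ H ρ
  open Reps.UnitaryRep ρ
  open ≈M-Reasoning
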